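{- Let $\Phi$ and $\Psi$ be constraint sets, let $x_1,\dots,x_n$ be resource variables not occurring in $\Psi$, and let $p_1,\dots,p_n,q_1,\dots,q_n$ be resource polynomials with $p_i\sqsubseteq_\Psi q_i$ for every $i$. If $x_1,\dots,x_n$ occur only positively in $\Phi$, then $\Phi\{\overline{p}/\overline{x}\}\cup\Psi\models\Phi\{\overline{q}/\overline{x}\}$. If $x_1,\dots,x_n$ occur only negatively in $\Phi$, then $\Phi\{\overline{q}/\overline{x}\}\cup\Psi\models\Phi\{\overline{p}/\overline{x}\}$.
   Context: A resource monomial over a set $X$ of variables is a finite product $\prod_{i}\binom{x_i}{n_i}$ of binomial coefficients with pairwise distinct $x_i\in X$ and $n_i\in\mathbb{N}$; a resource polynomial is a finite sum of resource monomials, interpreted as a function of natural-number valued variables. A constraint is an inequality $p\le q$ between resource polynomials; a constraint set is a finite set of constraints. $\Phi\models p\le q$ means that every assignment of natural numbers to the variables that satisfies all constraints in $\Phi$ satisfies $p\le q$; $\Phi\models\Psi$ means $\Phi\models c$ for every $c\in\Psi$; $p\sqsubseteq_\Psi q$ means $\Psi\models p\le q$. In a constraint $p\le q$ the variables of $p$ occur negatively and those of $q$ occur positively; a variable occurs only positively (negatively) in a constraint set if all its occurrences are positive (negative). $\Phi\{\overline{p}/\overline{x}\}$ denotes simultaneous substitution of $p_i$ for $x_i$ in all constraints of $\Phi$. -}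

module Defs where

open import Data.Nat using (ℕ; _*_; _+_; _≤_; _≟_)
open import Data.Nat.Combinatorics using (_C_)
open import Data.Fin using (Fin)
open import Data.List using (List; []; _∷_; map)
open import Data.List.Relation.Unary.All using (All)
open import Data.List.Relation.Unary.Any using (Any)
open import Data.List.Relation.Unary.Unique.Propositional using (Unique)
open import Data.Vec using (Vec; []; _∷_; lookup)
open import Data.Product using (_×_; _,_; proj₁; proj₂; map₁)
open import Relation.Binary.PropositionalEquality using (_≡_)
open import Relation.Nullary using (¬_; yes; no)

Var : Set
Var = ℕ

-- A monomial over atoms A: a finite product  ∏ binom(a_i , n_i),  a list of (a_i , n_i).
Mono : Set → Set
Mono A = List (A × ℕ)

Poly : Set → Set
Poly A = List (Mono A)

RPoly : Set
RPoly = Poly Var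

IsResourceMono : Mono Var → Set
IsResourceMono m = Unique (map proj₁ m)

IsResourcePoly : RPoly → Set
IsResourcePoly p = All IsResourceMono p

record Constraint (A : Set) : Set where
  constructor _≤ᶜ_
  field
    lhs : Poly A
    rhs : Poly A
open Constraint public

RConstraint : Set
RConstraint = Constraint Var

ConstraintSet : Set → Set
ConstraintSet A = List (Constraint A)

IsResourceConstraint : RConstraint → Set
IsResourceConstraint c = IsResourcePoly (lhs c) × IsResourcePoly (rhs c)

evalM : {A : Set} → (A → ℕ) → Mono A → ℕ
evalM v []            = 1
evalM v ((a , k) ∷ m) = (v a C k) * evalM v m

evalP : {A : Set} → (A → ℕ) → Poly A → ℕ
evalP v []      = 0
evalP v (m ∷ p) = evalM v m + evalP v p

SatC : {A : Set} → (A → ℕ) → Constraint A → Set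
SatC v c = evalP v (lhs c) ≤ evalP v (rhs c)

Assignment : Set
Assignment = Var → ℕ

_⊨_ : ConstraintSet Var → RConstraint → Set
Φ ⊨ c = (ρ : Assignment) → All (SatC ρ) Φ → SatC ρ c

_⊑[_]_ : RPoly → ConstraintSet Var → RPoly → Set
p ⊑[ Ψ ] q = Ψ ⊨ (p ≤ᶜ q)

OccursIn : Var → RPoly → Set
OccursIn x p = Any (Any (λ f → proj₁ f ≡ x)) p

NotOccurring : Var → ConstraintSet Var → Set
NotOccurring x Ψ = All (λ c → ¬ OccursIn x (lhs c) × ¬ OccursIn x (rhs c)) Ψ

OnlyPositive : Var → ConstraintSet Var → Set
OnlyPositive x Φ = All (λ c → ¬ OccursIn x (lhs c)) Φ

OnlyNegative : Var → ConstraintSet Var → Set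
OnlyNegative x Φ = All (λ c → ¬ OccursIn x (rhs c)) Φ

-- Simultaneous substitution of ps for xs.  A non-substituted variable y is
-- mapped to the resource polynomial  binom(y,1)  (which denotes y).
substVar : {n : ℕ} → Vec Var n → Vec RPoly n → Var → RPoly
substVar []       []       y = ((y , 1) ∷ []) ∷ []
substVar (x ∷ xs) (p ∷ ps) y with x ≟ y
... | yes _ = p
... | no  _ = substVar xs ps y

-- The result of substitution is a polynomial whose atoms are resource
-- polynomials: binom(x,k) becomes binom(σ x , k).
substP : {n : ℕ} → Vec Var n → Vec RPoly n → RPoly → Poly RPoly
substP xs ps = map (map (map₁ (substVar xs ps)))

substΦ : {n : ℕ} → ConstraintSet Var → Vec Var n → Vec RPoly n → ConstraintSet RPoly
substΦ Φ xs ps = map (λ c → substP xs ps (lhs c) ≤ᶜ substP xs ps (rhs c)) Φ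

_∪_⊨ˢ_ : ConstraintSet RPoly → ConstraintSet Var → ConstraintSet RPoly → Set
Φ' ∪ Ψ ⊨ˢ Φ'' = (ρ : Assignment) → All (SatC (evalP ρ)) Φ' → All (SatC ρ) Ψ → All (SatC (evalP ρ)) Φ''

module Submission where

open import Defs
open import Data.Nat using (ℕ)
open import Data.Fin using (Fin)
open import Data.Vec using (Vec; lookup)
open import Data.Vec.Relation.Unary.Unique.Propositional using (Unique)
open import Data.List.Relation.Unary.All using (All)
open import Data.Product using (_×_)

open import Data.Nat using (zero; suc; _+_; _*_; _≤_; _≤′_; ≤′-refl; ≤′-step; _≟_)
open import Data.Nat.Properties using (≤-refl; ≤-reflexive; ≤-trans; m≤n+m; ≤⇒≤′; +-mono-≤; *-mono-≤)
open import Data.Nat.Combinatorics using (_C_; nCk+nC[k+1]≡[n+1]C[k+1])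
open import Data.Fin using (zero; suc)
open import Data.List using ([]; _∷_; map)
open import Data.List.Membership.Propositional using (_∈_)
import Data.List.Relation.Unary.All as All
open import Data.List.Relation.Unary.All.Properties using (map⁺; map⁻)
open import Data.List.Relation.Unary.Any using (Any; here; there)
open import Data.Vec using ([]; _∷_)
open import Data.Product using (_,_; proj₁; map₁)
open import Function using (_∘_)
open import Relation.Binary.Core using (Rel)
open import Relation.Binary.Definitions using (Reflexive)
open import Relation.Binary.PropositionalEquality
  using (_≡_; _≢_; refl; sym; trans; cong; cong₂; subst; subst₂)
open import Relation.Nullary using (¬_; yes; no)
open import Data.Empty using (⊥-elim)

-- Substituting p̄ for x̄ and then evaluating at ρ is evaluating under the
-- valuation y ↦ ρ(σ y).  As the valuation grows, binomials grow, so a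
-- constraint stays satisfied when its right-hand side valuation grows and its
-- left-hand side valuation shrinks.  Since p̄ ≤ q̄ under Ψ, replacing p̄ by q̄
-- raises the valuation everywhere; and since x̄ is absent from the negative
-- (positive) side, that side is unchanged.

nCk≤[1+n]Ck : ∀ n k → n C k ≤ suc n C k
nCk≤[1+n]Ck n zero    = ≤-refl
nCk≤[1+n]Ck n (suc k) =
  subst (n C suc k ≤_) (nCk+nC[k+1]≡[n+1]C[k+1] n k) (m≤n+m _ _)

C-monoˡ-≤ : ∀ {m n} k → m ≤ n → m C k ≤ n C k
C-monoˡ-≤ k = go ∘ ≤⇒≤′
  where
  go : ∀ {m n} → m ≤′ n → m C k ≤ n C k
  go ≤′-refl        = ≤-refl
  go (≤′-step m≤′n) = ≤-trans (go m≤′n) (nCk≤[1+n]Ck _ k)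

module _ {A : Set} where

  AtomOf : A → Mono A → Set
  AtomOf a = Any (λ e → proj₁ e ≡ a)

  evalM-mono : (f g : A → ℕ) (m : Mono A) → (∀ a → AtomOf a m → f a ≤ g a) →
               evalM f m ≤ evalM g m
  evalM-mono f g []            f≤g = ≤-refl
  evalM-mono f g ((a , k) ∷ m) f≤g =
    *-mono-≤ (C-monoˡ-≤ k (f≤g a (here refl))) (evalM-mono f g m (λ b → f≤g b ∘ there))

  evalP-mono : (f g : A → ℕ) (p : Poly A) → (∀ a → Any (AtomOf a) p → f a ≤ g a) →
               evalP f p ≤ evalP g p
  evalP-mono f g []      f≤g = ≤-refl
  evalP-mono f g (m ∷ p) f≤g =
    +-mono-≤ (evalM-mono f g m (λ a → f≤g a ∘ here)) (evalP-mono f g p (λ a → f≤g a ∘ there))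

  SatC-transfer : (f g : A → ℕ) (c : Constraint A) →
                  (∀ a → Any (AtomOf a) (lhs c) → g a ≤ f a) →
                  (∀ a → Any (AtomOf a) (rhs c) → f a ≤ g a) →
                  SatC f c → SatC g c
  SatC-transfer f g c g≤fˡ f≤gʳ sat =
    ≤-trans (evalP-mono g f (lhs c) g≤fˡ) (≤-trans sat (evalP-mono f g (rhs c) f≤gʳ))

module _ {A : Set} (v : A → ℕ) (s : Var → A) where

  evalM-map : (m : Mono Var) → evalM v (map (map₁ s) m) ≡ evalM (v ∘ s) m
  evalM-map []            = refl
  evalM-map ((a , k) ∷ m) = cong ((v (s a) C k) *_) (evalM-map m)

  evalP-map : (p : RPoly) → evalP v (map (map (map₁ s)) p) ≡ evalP (v ∘ s) p
  evalP-map []      = refl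
  evalP-map (m ∷ p) = cong₂ _+_ (evalM-map m) (evalP-map p)

substVar-pointwise : ∀ {n ℓ} (R : Rel RPoly ℓ) → Reflexive R →
                     (xs : Vec Var n) (ps qs : Vec RPoly n) →
                     (∀ i → R (lookup ps i) (lookup qs i)) →
                     ∀ y → R (substVar xs ps y) (substVar xs qs y)
substVar-pointwise R refl′ []       []       []       R-ps-qs y = refl′
substVar-pointwise R refl′ (x ∷ xs) (p ∷ ps) (q ∷ qs) R-ps-qs y with x ≟ y
... | yes _ = R-ps-qs zero
... | no  _ = substVar-pointwise R refl′ xs ps qs (R-ps-qs ∘ suc) y

substVar-fresh : ∀ {n} (xs : Vec Var n) (ps : Vec RPoly n) y → (∀ i → lookup xs i ≢ y) →
                 substVar xs ps y ≡ ((y , 1) ∷ []) ∷ []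
substVar-fresh []       []       y fresh = refl
substVar-fresh (x ∷ xs) (p ∷ ps) y fresh with x ≟ y
... | yes x≡y = ⊥-elim (fresh zero x≡y)
... | no  _   = substVar-fresh xs ps y (fresh ∘ suc)

module Substitution {n : ℕ} (xs : Vec Var n) (ρ : Assignment) where

  substVal : Vec RPoly n → Assignment
  substVal ps y = evalP ρ (substVar xs ps y)

  substΦ-transfer : (Φ : ConstraintSet Var) (ps qs : Vec RPoly n) →
                    (∀ {c} → c ∈ Φ → SatC (substVal ps) c → SatC (substVal qs) c) →
                    All (SatC (evalP ρ)) (substΦ Φ xs ps) → All (SatC (evalP ρ)) (substΦ Φ xs qs)
  substΦ-transfer Φ ps qs transfer satΦ =
    map⁺ (All.tabulate λ {c} c∈Φ →
      unfold qs c (transfer c∈Φ (fold ps c (All.lookup (map⁻ satΦ) c∈Φ))))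
    where
    evalP-substP : ∀ rs p → evalP (evalP ρ) (substP xs rs p) ≡ evalP (substVal rs) p
    evalP-substP rs = evalP-map (evalP ρ) (substVar xs rs)

    fold : ∀ rs c → SatC (evalP ρ) (substP xs rs (lhs c) ≤ᶜ substP xs rs (rhs c)) →
           SatC (substVal rs) c
    fold rs c = subst₂ _≤_ (evalP-substP rs (lhs c)) (evalP-substP rs (rhs c))

    unfold : ∀ rs c → SatC (substVal rs) c →
             SatC (evalP ρ) (substP xs rs (lhs c) ≤ᶜ substP xs rs (rhs c))
    unfold rs c = subst₂ _≤_ (sym (evalP-substP rs (lhs c))) (sym (evalP-substP rs (rhs c)))

  substVal-mono : (ps qs : Vec RPoly n) →
                  (∀ i → evalP ρ (lookup ps i) ≤ evalP ρ (lookup qs i)) →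
                  ∀ y → substVal ps y ≤ substVal qs y
  substVal-mono = substVar-pointwise (λ p q → evalP ρ p ≤ evalP ρ q) ≤-refl xs

  substVal-fresh : (ps qs : Vec RPoly n) (p : RPoly) → (∀ i → ¬ OccursIn (lookup xs i) p) →
                   ∀ y → Any (AtomOf y) p → substVal ps y ≤ substVal qs y
  substVal-fresh ps qs p x̄∉p y y∈p = ≤-reflexive (cong (evalP ρ)
    (trans (substVar-fresh xs ps y xs≢y) (sym (substVar-fresh xs qs y xs≢y))))
    where
    xs≢y : ∀ i → lookup xs i ≢ y
    xs≢y i refl = x̄∉p i y∈p

-- Only p̄ ⊑Ψ q̄ is used: Ψ is read under the unsubstituted assignment, so x̄ need
-- not be fresh for it, substVar takes the first matching xᵢ, so x̄ need not be
-- distinct, and evaluation makes sense for arbitrary polynomials.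
lemma2p4 : (Φ Ψ : ConstraintSet Var) (n : ℕ) (xs : Vec Var n) (ps qs : Vec RPoly n)
    → All IsResourceConstraint Φ → All IsResourceConstraint Ψ
    → (∀ i → IsResourcePoly (lookup ps i)) → (∀ i → IsResourcePoly (lookup qs i))
    → Unique xs
    → (∀ i → NotOccurring (lookup xs i) Ψ)
    → (∀ i → lookup ps i ⊑[ Ψ ] lookup qs i)
    → ((∀ i → OnlyPositive (lookup xs i) Φ) → substΦ Φ xs ps ∪ Ψ ⊨ˢ substΦ Φ xs qs)
    × ((∀ i → OnlyNegative (lookup xs i) Φ) → substΦ Φ xs qs ∪ Ψ ⊨ˢ substΦ Φ xs ps)
lemma2p4 Φ Ψ n xs ps qs _ _ _ _ _ _ p̄⊑q̄ = positive , negative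
  where
  positive : (∀ i → OnlyPositive (lookup xs i) Φ) → substΦ Φ xs ps ∪ Ψ ⊨ˢ substΦ Φ xs qs
  positive x̄⁺ ρ satΦ satΨ = substΦ-transfer Φ ps qs (λ {c} c∈Φ →
      SatC-transfer (substVal ps) (substVal qs) c
        (substVal-fresh qs ps (lhs c) (λ i → All.lookup (x̄⁺ i) c∈Φ))
        (λ y _ → substVal-mono ps qs (λ i → p̄⊑q̄ i ρ satΨ) y))
    satΦ
    where open Substitution xs ρ

  negative : (∀ i → OnlyNegative (lookup xs i) Φ) → substΦ Φ xs qs ∪ Ψ ⊨ˢ substΦ Φ xs ps
  negative x̄⁻ ρ satΦ satΨ = substΦ-transfer Φ qs ps (λ {c} c∈Φ →
      SatC-transfer (substVal qs) (substVal ps) c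
        (λ y _ → substVal-mono ps qs (λ i → p̄⊑q̄ i ρ satΨ) y)
        (substVal-fresh qs ps (rhs c) (λ i → All.lookup (x̄⁻ i) c∈Φ)))
    satΦ
    where open Substitution xs ρ
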